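{- Let $r\ge 1$ be an integer. For all positive integers $i$ and $n$ with $i\neq rn$, $$\sum_k{\begin{bmatrix} n\\ k\end{bmatrix}}_{q^r}A^{(r)}_{k,rn-i-1}(q)=\sum_k{\begin{bmatrix} n\\ k\end{bmatrix}}_{q^r}A^{(r)}_{k,i-1}(q).$$
   Context: For a positive integer $n$ let $(z;q)_n=\prod_{i=0}^{n-1}(1-zq^i)$, $(z;q)_0=1$, and $e(z;q)=\sum_{n\ge0}z^n/(q;q)_n$. For an integer $r\ge1$ the polynomials $A^{(r)}_n(t,q)$ are defined by $$\frac{e(z;q^r)-e(t^rz;q^r)}{e(t^rz;q^r)-t\,e(z;q^r)}=\sum_{n\ge 1}A^{(r)}_n(t,q)\frac{z^n}{(q^r;q^r)_n},$$ with $A^{(r)}_0(t,q)=0$, and $A^{(r)}_{n,i}(q)$ is the coefficient of $t^i$ in $A^{(r)}_n(t,q)$ (zero for $i$ negative or beyond the degree). The $q$-binomial coefficient is ${\begin{bmatrix} n\\ k\end{bmatrix}}_{q}=\frac{(q;q)_n}{(q;q)_{n-k}(q;q)_k}$ for $0\le k\le n$ and $0$ otherwise; here it is evaluated at $q^r$. -}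

module Defs where

open import Data.Nat as ℕ using (ℕ; zero; suc; _∸_; _≤?_)
open import Data.Integer as ℤ using (ℤ; +_; -[1+_])
open import Data.Bool using (Bool; true; false; _∧_; if_then_else_)
open import Relation.Nullary using (yes; no; does)

sumTo : ℕ → (ℕ → ℤ) → ℤ
sumTo zero    f = + 0
sumTo (suc n) f = sumTo n f ℤ.+ f n

-- Formal power series in two variables t, q with integer coefficients:
-- S a b = coefficient of t^a q^b.  (Polynomials are embedded in these.)
Ser2 : Set
Ser2 = ℕ → ℕ → ℤ

0S : Ser2
0S _ _ = + 0

mono : ℕ → ℕ → Ser2
mono a b i j = if does (i ℕ.≟ a) ∧ does (j ℕ.≟ b) then + 1 else + 0

1S : Ser2
1S = mono 0 0

infixl 6 _⊕_ _⊖_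
infixl 7 _⊗_

_⊕_ : Ser2 → Ser2 → Ser2
(f ⊕ g) a b = f a b ℤ.+ g a b

_⊖_ : Ser2 → Ser2 → Ser2
(f ⊖ g) a b = f a b ℤ.- g a b

_⊗_ : Ser2 → Ser2 → Ser2
(f ⊗ g) a b = sumTo (suc a) λ i → sumTo (suc b) λ j → f i j ℤ.* g (a ∸ i) (b ∸ j)

sumS : ℕ → (ℕ → Ser2) → Ser2
sumS n F a b = sumTo n λ k → F k a b

pow : Ser2 → ℕ → Ser2
pow f zero    = 1S
pow f (suc m) = pow f m ⊗ f

-- Multiplicative inverse of a series f with constant term 1:
-- f⁻¹ = Σ_m (1 - f)^m; the coefficient of t^a q^b only involves m ≤ a + b.
inv : Ser2 → Ser2
inv f a b = sumTo (suc (a ℕ.+ b)) λ m → pow (1S ⊖ f) m a b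

qPoch : ℕ → ℕ → Ser2
qPoch r zero    = 1S
qPoch r (suc n) = qPoch r n ⊗ (1S ⊖ mono 0 (r ℕ.* suc n))

-- coefficient of z^n in e(z; q^r), i.e. 1/(q^r;q^r)_n
eCoef : ℕ → ℕ → Ser2
eCoef r n = inv (qPoch r n)

-- coefficient of z^n in e(t^r z; q^r), i.e. t^{rn}/(q^r;q^r)_n
eCoefT : ℕ → ℕ → Ser2
eCoefT r n = mono (r ℕ.* n) 0 ⊗ eCoef r n

-- z^n-coefficients of numerator e(z)-e(t^r z) and denominator e(t^r z)-t e(z)
Num : ℕ → ℕ → Ser2
Num r n = eCoef r n ⊖ eCoefT r n

Den : ℕ → ℕ → Ser2
Den r n = eCoefT r n ⊖ mono 1 0 ⊗ eCoef r n

-- Power series division in z: the quotient F = Num / Den, with Den_0 = 1 - t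
-- invertible.  F_n = Den_0⁻¹ (Num_n - Σ_{k<n} F_k Den_{n-k}).
step : ℕ → (ℕ → Ser2) → ℕ → Ser2
step r G n = inv (Den r 0) ⊗ (Num r n ⊖ sumS n (λ k → G k ⊗ Den r (n ∸ k)))

-- Fupto r n k = F_k for k ≤ n
Fupto : ℕ → ℕ → ℕ → Ser2
Fupto r zero    k = step r (λ _ → 0S) 0
Fupto r (suc n) k with k ≤? n
... | yes _ = Fupto r n k
... | no  _ = step r (Fupto r n) (suc n)

Fcoef : ℕ → ℕ → Ser2
Fcoef r n = Fupto r n n

A : ℕ → ℕ → Ser2
A r n = Fcoef r n ⊗ qPoch r n

-- A^{(r)}_{n,m}(q) : coefficient of t^m (zero for negative m), as a q-series
Acoef : ℕ → ℕ → ℤ → ℕ → ℤ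
Acoef r n (+ m)     j = A r n m j
Acoef r n -[1+ m ]  j = + 0

qbin : ℕ → ℕ → ℕ → ℕ → ℤ
qbin r n k j with k ≤? n
... | yes _ = (qPoch r n ⊗ inv (qPoch r (n ∸ k)) ⊗ inv (qPoch r k)) 0 j
... | no  _ = + 0

qconv : (ℕ → ℤ) → (ℕ → ℤ) → ℕ → ℤ
qconv f g j = sumTo (suc j) λ b → f b ℤ.* g (j ∸ b)

-- Clearing denominators in F = Num / Den, where F = Σ A_n z^n / (q^r;q^r)_n, gives the recurrence
--   Σ_{k ≤ n} [n k] A_k (t^{r(n-k)} - t) = 1 - t^{rn}.
-- Its k = n term is A_n (1 - t). If every A_k with k < n is palindromic (A_{k,m} = A_{k,rk-1-m}),
-- each other term, and 1 - t^{rn} itself, is antisymmetric under t^m ↦ t^{rn-m}; hence so is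
-- A_n (1 - t), which makes A_n palindromic. Using palindromicity in every term, the coefficient
-- of t^i in the recurrence reads
--   Σ_k [n k] A_{k,rn-1-i} - Σ_k [n k] A_{k,i-1} = [t^i] (1 - t^{rn}),
-- and the right-hand side vanishes for 0 < i ≠ rn.
module Submission where

open import Algebra.Bundles using (CommutativeRing; RawRing)
import Algebra.Construct.Pointwise as Pointwise
open import Algebra.Morphism.Structures using (IsRingMonomorphism)
import Algebra.Morphism.RingMonomorphism as RingMonomorphism
open import Algebra.Structures using (IsCommutativeRing)
open import Data.Bool using (if_then_else_; _∧_)
open import Data.Bool.Properties using (∧-zeroʳ)
open import Data.Empty using (⊥-elim)
open import Data.Integer as ℤ using (ℤ; +_; -[1+_])
import Data.Integer.Properties as ℤP
open import Data.Integer.Tactic.RingSolver using (solve-∀)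
open import Data.Nat as ℕ using (ℕ; zero; suc; _∸_; _<_; _≤_; z≤n; s≤s)
open import Data.Nat.Induction using (<-rec)
import Data.Nat.Properties as ℕP
open import Data.Product using (_,_)
open import Function using (_∘_; id)
open import Relation.Binary.PropositionalEquality as ≡ using (_≡_; _≢_; cong; cong₂)
open import Relation.Nullary using (yes; no; does)
open import Relation.Nullary.Decidable using (dec-true; dec-false)

open import Defs

module FiniteSums {c ℓ} (R : CommutativeRing c ℓ) where

  open CommutativeRing R
  open import Relation.Binary.Reasoning.Setoid setoid

  ∑ : ℕ → (ℕ → Carrier) → Carrier
  ∑ zero    f = 0#
  ∑ (suc n) f = ∑ n f + f n

  ∑-cong : ∀ n {f g} → (∀ i → i < n → f i ≈ g i) → ∑ n f ≈ ∑ n g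
  ∑-cong zero    f≈g = refl
  ∑-cong (suc n) f≈g = +-cong (∑-cong n (λ i i<n → f≈g i (ℕP.m<n⇒m<1+n i<n))) (f≈g n ℕP.≤-refl)

  ∑-zero : ∀ n {f} → (∀ i → i < n → f i ≈ 0#) → ∑ n f ≈ 0#
  ∑-zero zero    f≈0 = refl
  ∑-zero (suc n) f≈0 =
    trans (+-cong (∑-zero n (λ i i<n → f≈0 i (ℕP.m<n⇒m<1+n i<n))) (f≈0 n ℕP.≤-refl)) (+-identityʳ 0#)

  ∑-distrib-+ : ∀ n f g → ∑ n (λ i → f i + g i) ≈ ∑ n f + ∑ n g
  ∑-distrib-+ zero    f g = sym (+-identityʳ 0#)
  ∑-distrib-+ (suc n) f g = begin
    ∑ n (λ i → f i + g i) + (f n + g n) ≈⟨ +-congʳ (∑-distrib-+ n f g) ⟩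
    (∑ n f + ∑ n g) + (f n + g n)       ≈⟨ interchange (∑ n f) (∑ n g) (f n) (g n) ⟩
    (∑ n f + f n) + (∑ n g + g n)       ∎
    where open import Algebra.Properties.CommutativeSemigroup +-commutativeSemigroup using (interchange)

  ∑-distribˡ : ∀ n x f → x * ∑ n f ≈ ∑ n (λ i → x * f i)
  ∑-distribˡ zero    x f = zeroʳ x
  ∑-distribˡ (suc n) x f = trans (distribˡ x _ _) (+-congʳ (∑-distribˡ n x f))

  ∑-distribʳ : ∀ n x f → ∑ n f * x ≈ ∑ n (λ i → f i * x)
  ∑-distribʳ n x f = trans (*-comm _ x) (trans (∑-distribˡ n x f) (∑-cong n (λ i _ → *-comm x (f i))))

  ∑-unconsˡ : ∀ n f → ∑ (suc n) f ≈ f 0 + ∑ n (λ i → f (suc i))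
  ∑-unconsˡ zero    f = trans (+-identityˡ _) (sym (+-identityʳ _))
  ∑-unconsˡ (suc n) f = trans (+-congʳ (∑-unconsˡ n f)) (+-assoc _ _ _)

  ∑-reverse : ∀ n f → ∑ (suc n) f ≈ ∑ (suc n) (λ i → f (n ∸ i))
  ∑-reverse zero    f = refl
  ∑-reverse (suc n) f = begin
    ∑ (suc n) f + f (suc n)                  ≈⟨ +-congʳ (∑-reverse n f) ⟩
    ∑ (suc n) (λ i → f (n ∸ i)) + f (suc n)  ≈⟨ +-comm _ _ ⟩
    f (suc n) + ∑ (suc n) (λ i → f (n ∸ i))  ≈⟨ ∑-unconsˡ (suc n) (λ i → f (suc n ∸ i)) ⟨
    ∑ (suc (suc n)) (λ i → f (suc n ∸ i))    ∎

  ∑-single : ∀ n f k → k < n → (∀ i → i < n → i ≢ k → f i ≈ 0#) → ∑ n f ≈ f k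
  ∑-single (suc n) f k k<1+n f≈0 with k ℕ.≟ n
  ... | yes ≡.refl = trans (+-congʳ (∑-zero n (λ i i<n → f≈0 i (ℕP.m<n⇒m<1+n i<n) (ℕP.<⇒≢ i<n)))) (+-identityˡ _)
  ... | no k≢n =
    trans (+-cong (∑-single n f k (ℕP.≤∧≢⇒< (ℕP.≤-pred k<1+n) k≢n) (λ i i<n → f≈0 i (ℕP.m<n⇒m<1+n i<n)))
                  (f≈0 n ℕP.≤-refl (k≢n ∘ ≡.sym)))
          (+-identityʳ _)

  ∑-triangle : ∀ n (u : ℕ → ℕ → Carrier) →
    ∑ (suc n) (λ l → ∑ (suc l) (λ i → u i l)) ≈ ∑ (suc n) (λ i → ∑ (suc (n ∸ i)) (λ k → u i (i ℕ.+ k)))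
  ∑-triangle zero    u = refl
  ∑-triangle (suc n) u = begin
    ∑ (suc n) (λ l → ∑ (suc l) (λ i → u i l)) + (∑ (suc n) (λ i → u i (suc n)) + u (suc n) (suc n))
      ≈⟨ +-congʳ (∑-triangle n u) ⟩
    inner n + (∑ (suc n) (λ i → u i (suc n)) + u (suc n) (suc n))
      ≈⟨ +-assoc _ _ _ ⟨
    (inner n + ∑ (suc n) (λ i → u i (suc n))) + u (suc n) (suc n)
      ≈⟨ +-congʳ (∑-distrib-+ (suc n) _ _) ⟨
    ∑ (suc n) (λ i → ∑ (suc (n ∸ i)) (λ k → u i (i ℕ.+ k)) + u i (suc n)) + u (suc n) (suc n)
      ≈⟨ +-cong (∑-cong (suc n) extend) (sym (trans (+-identityˡ _) (reflexive (cong (u (suc n)) (ℕP.+-identityʳ (suc n)))))) ⟩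
    ∑ (suc n) (λ i → ∑ (suc (suc n ∸ i)) (λ k → u i (i ℕ.+ k))) + (0# + u (suc n) (suc n ℕ.+ 0))
      ≈⟨ +-congˡ (reflexive (cong (λ m → ∑ (suc m) (λ k → u (suc n) (suc n ℕ.+ k))) (ℕP.n∸n≡0 n))) ⟨
    ∑ (suc (suc n)) (λ i → ∑ (suc (suc n ∸ i)) (λ k → u i (i ℕ.+ k))) ∎
    where
    inner : ℕ → Carrier
    inner m = ∑ (suc m) (λ i → ∑ (suc (m ∸ i)) (λ k → u i (i ℕ.+ k)))
    extend : ∀ i → i < suc n →
      ∑ (suc (n ∸ i)) (λ k → u i (i ℕ.+ k)) + u i (suc n) ≈ ∑ (suc (suc n ∸ i)) (λ k → u i (i ℕ.+ k))
    extend i i<1+n = begin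
      ∑ (suc (n ∸ i)) (λ k → u i (i ℕ.+ k)) + u i (suc n)
        ≈⟨ +-congˡ (reflexive (cong (u i) 1+n≡i+[1+n∸i])) ⟩
      ∑ (suc (suc (n ∸ i))) (λ k → u i (i ℕ.+ k))
        ≡⟨ cong (λ m → ∑ (suc m) (λ k → u i (i ℕ.+ k))) (≡.sym (ℕP.+-∸-assoc 1 (ℕP.≤-pred i<1+n))) ⟩
      ∑ (suc (suc n ∸ i)) (λ k → u i (i ℕ.+ k)) ∎
      where
      1+n≡i+[1+n∸i] : suc n ≡ i ℕ.+ suc (n ∸ i)
      1+n≡i+[1+n∸i] = ≡.trans (cong suc (≡.sym (ℕP.m+[n∸m]≡n (ℕP.≤-pred i<1+n)))) (≡.sym (ℕP.+-suc i (n ∸ i)))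

module PowerSeries {c ℓ} (R : CommutativeRing c ℓ) where

  open CommutativeRing R
  open FiniteSums R
  open import Relation.Binary.Reasoning.Setoid setoid

  Series : Set c
  Series = ℕ → Carrier

  infix 4 _≋_
  _≋_ : Series → Series → Set ℓ
  f ≋ g = ∀ n → f n ≈ g n

  infixl 7 _⋆_
  _⋆_ : Series → Series → Series
  (f ⋆ g) n = ∑ (suc n) (λ i → f i * g (n ∸ i))

  1ₛ : Series
  1ₛ zero    = 1#
  1ₛ (suc n) = 0#

  ⋆-cong : ∀ {f f′ g g′} → f ≋ f′ → g ≋ g′ → f ⋆ g ≋ f′ ⋆ g′
  ⋆-cong f≋f′ g≋g′ n = ∑-cong (suc n) (λ i _ → *-cong (f≋f′ i) (g≋g′ (n ∸ i)))

  ⋆-comm : ∀ f g → f ⋆ g ≋ g ⋆ f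
  ⋆-comm f g n = trans (∑-reverse n _) (∑-cong (suc n) (λ i i<1+n →
    trans (*-comm _ _) (*-congʳ (reflexive (cong g (ℕP.m∸[m∸n]≡n (ℕP.≤-pred i<1+n)))))))

  ⋆-assoc : ∀ f g h → (f ⋆ g) ⋆ h ≋ f ⋆ (g ⋆ h)
  ⋆-assoc f g h n = begin
    ∑ (suc n) (λ l → ∑ (suc l) (λ i → f i * g (l ∸ i)) * h (n ∸ l))
      ≈⟨ ∑-cong (suc n) (λ l _ → ∑-distribʳ (suc l) _ _) ⟩
    ∑ (suc n) (λ l → ∑ (suc l) (λ i → f i * g (l ∸ i) * h (n ∸ l)))
      ≈⟨ ∑-triangle n (λ i l → f i * g (l ∸ i) * h (n ∸ l)) ⟩
    ∑ (suc n) (λ i → ∑ (suc (n ∸ i)) (λ k → f i * g (i ℕ.+ k ∸ i) * h (n ∸ (i ℕ.+ k))))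
      ≈⟨ ∑-cong (suc n) (λ i _ → ∑-cong (suc (n ∸ i)) (λ k _ → trans (*-assoc _ _ _)
           (*-congˡ (*-cong (reflexive (cong g (ℕP.m+n∸m≡n i k)))
                            (reflexive (cong h (≡.sym (ℕP.∸-+-assoc n i k)))))))) ⟩
    ∑ (suc n) (λ i → ∑ (suc (n ∸ i)) (λ k → f i * (g k * h (n ∸ i ∸ k))))
      ≈⟨ ∑-cong (suc n) (λ i _ → ∑-distribˡ (suc (n ∸ i)) _ _) ⟨
    ∑ (suc n) (λ i → f i * ∑ (suc (n ∸ i)) (λ k → g k * h (n ∸ i ∸ k))) ∎

  ⋆-identityʳ : ∀ f → f ⋆ 1ₛ ≋ f
  ⋆-identityʳ f n = begin
    ∑ (suc n) (λ i → f i * 1ₛ (n ∸ i)) ≈⟨ ∑-single (suc n) _ n ℕP.≤-refl off-diagonal ⟩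
    f n * 1ₛ (n ∸ n)                  ≡⟨ cong (λ m → f n * 1ₛ m) (ℕP.n∸n≡0 n) ⟩
    f n * 1#                          ≈⟨ *-identityʳ (f n) ⟩
    f n                               ∎
    where
    off-diagonal : ∀ i → i < suc n → i ≢ n → f i * 1ₛ (n ∸ i) ≈ 0#
    off-diagonal i i<1+n i≢n with n ∸ i in n∸i≡
    ... | zero  = ⊥-elim (i≢n (ℕP.≤-antisym (ℕP.≤-pred i<1+n) (ℕP.m∸n≡0⇒m≤n n∸i≡)))
    ... | suc _ = zeroʳ (f i)

  ⋆-identityˡ : ∀ f → 1ₛ ⋆ f ≋ f
  ⋆-identityˡ f n = trans (⋆-comm 1ₛ f n) (⋆-identityʳ f n)

  ⋆-distribˡ : ∀ h f g → h ⋆ (λ n → f n + g n) ≋ λ n → (h ⋆ f) n + (h ⋆ g) n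
  ⋆-distribˡ h f g n = trans (∑-cong (suc n) (λ i _ → distribˡ _ _ _)) (∑-distrib-+ (suc n) _ _)

  ⋆-distribʳ : ∀ h f g → (λ n → f n + g n) ⋆ h ≋ λ n → (f ⋆ h) n + (g ⋆ h) n
  ⋆-distribʳ h f g n = trans (∑-cong (suc n) (λ i _ → distribʳ _ _ _)) (∑-distrib-+ (suc n) _ _)

  Series-isCommutativeRing : IsCommutativeRing _≋_ (λ f g n → f n + g n) _⋆_ (λ f n → - f n) (λ _ → 0#) 1ₛ
  Series-isCommutativeRing = record
    { isRing = record
      { +-isAbelianGroup = Pointwise.isAbelianGroup ℕ +-isAbelianGroup
      ; *-cong           = ⋆-cong
      ; *-assoc          = ⋆-assoc
      ; *-identity       = ⋆-identityˡ , ⋆-identityʳ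
      ; distrib          = ⋆-distribˡ , ⋆-distribʳ
      }
    ; *-comm = ⋆-comm
    }

  Series-commutativeRing : CommutativeRing c ℓ
  Series-commutativeRing = record { isCommutativeRing = Series-isCommutativeRing }

-- Ser2 as the ring of power series over power series over ℤ

module ℤSum = FiniteSums ℤP.+-*-commutativeRing

sumTo≡∑ : ∀ n f → sumTo n f ≡ ℤSum.∑ n f
sumTo≡∑ zero    f = ≡.refl
sumTo≡∑ (suc n) f = cong (ℤ._+ f n) (sumTo≡∑ n f)

sumTo-cong : ∀ n {f g} → (∀ i → i < n → f i ≡ g i) → sumTo n f ≡ sumTo n g
sumTo-cong n {f} {g} f≡g = ≡.trans (sumTo≡∑ n f) (≡.trans (ℤSum.∑-cong n f≡g) (≡.sym (sumTo≡∑ n g)))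

sumTo-zero : ∀ n {f} → (∀ i → i < n → f i ≡ + 0) → sumTo n f ≡ + 0
sumTo-zero n {f} f≡0 = ≡.trans (sumTo≡∑ n f) (ℤSum.∑-zero n f≡0)

sumTo-single : ∀ n f k → k < n → (∀ i → i < n → i ≢ k → f i ≡ + 0) → sumTo n f ≡ f k
sumTo-single n f k k<n f≡0 = ≡.trans (sumTo≡∑ n f) (ℤSum.∑-single n f k k<n f≡0)

sumTo-distrib-− : ∀ n f g → sumTo n (λ k → f k ℤ.- g k) ≡ sumTo n f ℤ.- sumTo n g
sumTo-distrib-− zero    f g = ≡.refl
sumTo-distrib-− (suc n) f g =
  ≡.trans (cong (ℤ._+ (f n ℤ.- g n)) (sumTo-distrib-− n f g)) ([x-y]+[z-w]≡[x+z]-[y+w] (sumTo n f) (sumTo n g) (f n) (g n))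
  where
  [x-y]+[z-w]≡[x+z]-[y+w] : ∀ x y z w → (x ℤ.- y) ℤ.+ (z ℤ.- w) ≡ (x ℤ.+ z) ℤ.- (y ℤ.+ w)
  [x-y]+[z-w]≡[x+z]-[y+w] = solve-∀

module ℤSeries = PowerSeries ℤP.+-*-commutativeRing
module ℤSeries² = PowerSeries ℤSeries.Series-commutativeRing

⊗≋⋆ : ∀ X Y → X ⊗ Y ℤSeries².≋ X ℤSeries².⋆ Y
⊗≋⋆ X Y a b = ≡.trans (sumTo-cong (suc a) λ i _ → sumTo≡∑ (suc b) _) (≡.sym (∑-at (suc a) _))
  where
  ∑-at : ∀ n (F : ℕ → ℕ → ℤ) → FiniteSums.∑ ℤSeries.Series-commutativeRing n F b ≡ sumTo n (λ k → F k b)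
  ∑-at zero    F = ≡.refl
  ∑-at (suc n) F = cong (ℤ._+ F n b) (∑-at n F)

1S≋1ₛ : 1S ℤSeries².≋ ℤSeries².1ₛ
1S≋1ₛ zero    zero    = ≡.refl
1S≋1ₛ zero    (suc b) = ≡.refl
1S≋1ₛ (suc a) zero    = ≡.refl
1S≋1ₛ (suc a) (suc b) = ≡.refl

-- A record rather than a bare function type, so that unification recovers both sides.
infix 4 _≈₂_
record _≈₂_ (X Y : Ser2) : Set where
  constructor coeffwise
  field at : ∀ a b → X a b ≡ Y a b
open _≈₂_ public

infix 8 ⊝_
⊝_ : Ser2 → Ser2
(⊝ X) a b = ℤ.- X a b

Ser2-rawRing : RawRing _ _
Ser2-rawRing = record
  { Carrier = Ser2 ; _≈_ = _≈₂_ ; _+_ = _⊕_ ; _*_ = _⊗_ ; -_ = ⊝_ ; 0# = 0S ; 1# = 1S }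

id-isRingMonomorphism : IsRingMonomorphism Ser2-rawRing (CommutativeRing.rawRing ℤSeries².Series-commutativeRing) id
id-isRingMonomorphism = record
  { isRingHomomorphism = record
    { isSemiringHomomorphism = record
      { isNearSemiringHomomorphism = record
        { +-isMonoidHomomorphism = record
          { isMagmaHomomorphism = record
            { isRelHomomorphism = record { cong = at }
            ; homo = λ X Y a b → ≡.refl
            }
          ; ε-homo = λ a b → ≡.refl
          }
        ; *-homo = ⊗≋⋆
        }
      ; 1#-homo = 1S≋1ₛ
      }
    ; -‿homo = λ X a b → ≡.refl
    }
  ; injective = coeffwise
  }

Ser2-commutativeRing : CommutativeRing _ _
Ser2-commutativeRing = record
  { isCommutativeRing = RingMonomorphism.isCommutativeRing id-isRingMonomorphism
      (CommutativeRing.isCommutativeRing ℤSeries².Series-commutativeRing)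
  }

module Ser2 = CommutativeRing Ser2-commutativeRing
module Ser2Sum = FiniteSums Ser2-commutativeRing

-- Congruences with the fixed operand explicit: unification cannot see through
-- the pointwise definitions of the operations on Ser2.
⊗-congˡ : ∀ X {Y Y′} → Y ≈₂ Y′ → X ⊗ Y ≈₂ X ⊗ Y′
⊗-congˡ X = Ser2.*-cong (Ser2.refl {X})

⊗-congʳ : ∀ {X X′} Y → X ≈₂ X′ → X ⊗ Y ≈₂ X′ ⊗ Y
⊗-congʳ Y X≈X′ = Ser2.*-cong X≈X′ (Ser2.refl {Y})

⊕-congˡ : ∀ X {Y Y′} → Y ≈₂ Y′ → X ⊕ Y ≈₂ X ⊕ Y′
⊕-congˡ X = Ser2.+-cong (Ser2.refl {X})

⊖-cong : ∀ {X X′ Y Y′} → X ≈₂ X′ → Y ≈₂ Y′ → X ⊖ Y ≈₂ X′ ⊖ Y′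
⊖-cong X≈X′ Y≈Y′ = coeffwise λ a b → cong₂ ℤ._-_ (at X≈X′ a b) (at Y≈Y′ a b)

⊖-congˡ : ∀ X {Y Y′} → Y ≈₂ Y′ → X ⊖ Y ≈₂ X ⊖ Y′
⊖-congˡ X = ⊖-cong {X} (coeffwise λ a b → ≡.refl)

⊖-congʳ : ∀ {X X′} Y → X ≈₂ X′ → X ⊖ Y ≈₂ X′ ⊖ Y
⊖-congʳ Y X≈X′ = ⊖-cong {Y = Y} X≈X′ (coeffwise λ a b → ≡.refl)

sumS≈∑ : ∀ n F → sumS n F ≈₂ Ser2Sum.∑ n F
sumS≈∑ zero    F = coeffwise λ a b → ≡.refl
sumS≈∑ (suc n) F = coeffwise λ a b → cong (ℤ._+ F n a b) (at (sumS≈∑ n F) a b)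

sumS-cong : ∀ n {F G} → (∀ k → k < n → F k ≈₂ G k) → sumS n F ≈₂ sumS n G
sumS-cong n F≈G = coeffwise λ a b → sumTo-cong n λ k k<n → at (F≈G k k<n) a b

sumS-distribˡ : ∀ n X F → X ⊗ sumS n F ≈₂ sumS n (λ k → X ⊗ F k)
sumS-distribˡ n X F = begin
  X ⊗ sumS n F                 ≈⟨ ⊗-congˡ X (sumS≈∑ n F) ⟩
  X ⊗ Ser2Sum.∑ n F            ≈⟨ Ser2Sum.∑-distribˡ n X F ⟩
  Ser2Sum.∑ n (λ k → X ⊗ F k)  ≈⟨ sumS≈∑ n (λ k → X ⊗ F k) ⟨
  sumS n (λ k → X ⊗ F k)       ∎
  where open import Relation.Binary.Reasoning.Setoid Ser2.setoid

-- Inverse of a series with constant term 1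

module _ where

  open ≡.≡-Reasoning

  ⊗-coeff-zero : ∀ X Y a b → (∀ i j → i ≤ a → j ≤ b → X i j ℤ.* Y (a ∸ i) (b ∸ j) ≡ + 0) → (X ⊗ Y) a b ≡ + 0
  ⊗-coeff-zero X Y a b terms≡0 =
    sumTo-zero (suc a) λ i i≤a → sumTo-zero (suc b) λ j j≤b → terms≡0 i j (ℕP.≤-pred i≤a) (ℕP.≤-pred j≤b)

  ⊗-coeff-local : ∀ X Y Z a b → (∀ i j → i ≤ a → j ≤ b → X i j ≡ Y i j) → (X ⊗ Z) a b ≡ (Y ⊗ Z) a b
  ⊗-coeff-local X Y Z a b X≡Y =
    sumTo-cong (suc a) λ i i≤a → sumTo-cong (suc b) λ j j≤b →
      cong (ℤ._* Z (a ∸ i) (b ∸ j)) (X≡Y i j (ℕP.≤-pred i≤a) (ℕP.≤-pred j≤b))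

  pow-coeff-zero : ∀ g → g 0 0 ≡ + 0 → ∀ m a b → a ℕ.+ b < m → pow g m a b ≡ + 0
  pow-coeff-zero g g₀≡0 (suc m) a b a+b<1+m = ⊗-coeff-zero (pow g m) g a b term≡0
    where
    lower : ∀ i j → i ℕ.+ j < a ℕ.+ b → pow g m i j ≡ + 0
    lower i j i+j<a+b = pow-coeff-zero g g₀≡0 m i j (ℕP.<-≤-trans i+j<a+b (ℕP.≤-pred a+b<1+m))
    term≡0 : ∀ i j → i ≤ a → j ≤ b → pow g m i j ℤ.* g (a ∸ i) (b ∸ j) ≡ + 0
    term≡0 i j i≤a j≤b with a ∸ i in a∸i | b ∸ j in b∸j
    ... | zero  | zero  = ≡.trans (cong (pow g m i j ℤ.*_) g₀≡0) (ℤP.*-zeroʳ (pow g m i j))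
    ... | suc d | e     = ≡.trans (cong (ℤ._* g (suc d) e) (lower i j i+j<a+b)) (ℤP.*-zeroˡ (g (suc d) e))
      where i+j<a+b = ℕP.+-mono-<-≤ (ℕP.m∸n≢0⇒n<m (λ a∸i≡0 → ℕP.0≢1+n (≡.trans (≡.sym a∸i≡0) a∸i))) j≤b
    ... | zero  | suc e = ≡.trans (cong (ℤ._* g 0 (suc e)) (lower i j i+j<a+b)) (ℤP.*-zeroˡ (g 0 (suc e)))
      where i+j<a+b = ℕP.+-mono-≤-< i≤a (ℕP.m∸n≢0⇒n<m (λ b∸j≡0 → ℕP.0≢1+n (≡.trans (≡.sym b∸j≡0) b∸j)))

  geometric : Ser2 → ℕ → Ser2
  geometric g N = sumS (suc N) (pow g)

  geometric-stable : ∀ g → g 0 0 ≡ + 0 → ∀ a b d → geometric g (a ℕ.+ b ℕ.+ d) a b ≡ geometric g (a ℕ.+ b) a b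
  geometric-stable g g₀≡0 a b zero = cong (λ N → geometric g N a b) (ℕP.+-identityʳ (a ℕ.+ b))
  geometric-stable g g₀≡0 a b (suc d) = begin
    geometric g (a ℕ.+ b ℕ.+ suc d) a b
      ≡⟨ cong (λ N → geometric g N a b) (ℕP.+-suc (a ℕ.+ b) d) ⟩
    geometric g (a ℕ.+ b ℕ.+ d) a b ℤ.+ pow g (suc (a ℕ.+ b ℕ.+ d)) a b
      ≡⟨ cong₂ ℤ._+_ (geometric-stable g g₀≡0 a b d) (pow-coeff-zero g g₀≡0 _ a b (s≤s (ℕP.m≤m+n (a ℕ.+ b) d))) ⟩
    geometric g (a ℕ.+ b) a b ℤ.+ + 0
      ≡⟨ ℤP.+-identityʳ _ ⟩
    geometric g (a ℕ.+ b) a b ∎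

module _ where

  open CommutativeRing Ser2-commutativeRing
  open import Relation.Binary.Reasoning.Setoid setoid

  geometric-telescopes : ∀ g N → geometric g N ⊗ (1S ⊖ g) ≈ 1S ⊖ pow g (suc N)
  geometric-telescopes g zero = begin
    geometric g 0 ⊗ (1S ⊖ g)  ≈⟨ ⊗-congʳ (1S ⊖ g) (coeffwise λ a b → ℤP.+-identityˡ (1S a b)) ⟩
    1S ⊗ (1S ⊖ g)             ≈⟨ *-identityˡ (1S ⊖ g) ⟩
    1S ⊖ g                    ≈⟨ ⊖-congˡ 1S (*-identityˡ g) ⟨
    1S ⊖ 1S ⊗ g               ∎
  geometric-telescopes g (suc N) = begin
    (geometric g N ⊕ P) ⊗ (1S ⊖ g)                 ≈⟨ distribʳ (1S ⊖ g) (geometric g N) P ⟩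
    geometric g N ⊗ (1S ⊖ g) ⊕ P ⊗ (1S ⊖ g)        ≈⟨ +-cong (geometric-telescopes g N) (x[y-z]≈xy-xz P 1S g) ⟩
    (1S ⊖ P) ⊕ (P ⊗ 1S ⊖ P ⊗ g)                    ≈⟨ ⊕-congˡ (1S ⊖ P) (⊖-congʳ (P ⊗ g) (*-identityʳ P)) ⟩
    (1S ⊖ P) ⊕ (P ⊖ P ⊗ g)                         ≈⟨ coeffwise (λ a b → [x-y]+[y-z]≡x-z (1S a b) (P a b) ((P ⊗ g) a b)) ⟩
    1S ⊖ P ⊗ g                                     ∎
    where
    P = pow g (suc N)
    open import Algebra.Properties.Ring ring using (x[y-z]≈xy-xz)
    [x-y]+[y-z]≡x-z : ∀ x y z → (x ℤ.- y) ℤ.+ (y ℤ.- z) ≡ x ℤ.- z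
    [x-y]+[y-z]≡x-z = solve-∀

module _ where

  open ≡.≡-Reasoning

  inv-coeff : ∀ f → (1S ⊖ f) 0 0 ≡ + 0 → ∀ N a b → a ℕ.+ b ≤ N → inv f a b ≡ geometric (1S ⊖ f) N a b
  inv-coeff f g₀≡0 N a b a+b≤N with ℕP.m≤n⇒∃[o]m+o≡n a+b≤N
  ... | d , ≡.refl = ≡.sym (geometric-stable (1S ⊖ f) g₀≡0 a b d)

  -- Only coefficients of total degree ≤ a + b enter at (a, b); there inv f is the geometric
  -- sum up to a + b, which telescopes.
  inv-inverseˡ : ∀ f → f 0 0 ≡ + 1 → inv f ⊗ f ≈₂ 1S
  inv-inverseˡ f f₀≡1 = coeffwise λ a b → begin
    (inv f ⊗ f) a b
      ≡⟨ ⊗-coeff-local (inv f) (geometric g (a ℕ.+ b)) f a b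
           (λ i j i≤a j≤b → inv-coeff f g₀≡0 (a ℕ.+ b) i j (ℕP.+-mono-≤ i≤a j≤b)) ⟩
    (geometric g (a ℕ.+ b) ⊗ f) a b
      ≡⟨ at (⊗-congˡ (geometric g (a ℕ.+ b)) (coeffwise λ a b → ≡.sym (1-[1-x]≡x (1S a b) (f a b)))) a b ⟩
    (geometric g (a ℕ.+ b) ⊗ (1S ⊖ g)) a b
      ≡⟨ at (geometric-telescopes g (a ℕ.+ b)) a b ⟩
    1S a b ℤ.- pow g (suc (a ℕ.+ b)) a b
      ≡⟨ cong (λ x → 1S a b ℤ.- x) (pow-coeff-zero g g₀≡0 (suc (a ℕ.+ b)) a b ℕP.≤-refl) ⟩
    1S a b ℤ.- + 0
      ≡⟨ ℤP.+-identityʳ (1S a b) ⟩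
    1S a b ∎
    where
    g = 1S ⊖ f
    g₀≡0 : g 0 0 ≡ + 0
    g₀≡0 = cong (λ x → + 1 ℤ.- x) f₀≡1
    1-[1-x]≡x : ∀ o x → o ℤ.- (o ℤ.- x) ≡ x
    1-[1-x]≡x = solve-∀

  inv-inverseʳ : ∀ f → f 0 0 ≡ + 1 → f ⊗ inv f ≈₂ 1S
  inv-inverseʳ f f₀≡1 = Ser2.trans (Ser2.*-comm f (inv f)) (inv-inverseˡ f f₀≡1)

-- The recurrence for A

mono-≢ˡ : ∀ a b i j → i ≢ a → mono a b i j ≡ + 0
mono-≢ˡ a b i j i≢a =
  cong (λ x → if x ∧ does (j ℕ.≟ b) then + 1 else + 0) (dec-false (i ℕ.≟ a) i≢a)

mono-≢ʳ : ∀ a b i j → j ≢ b → mono a b i j ≡ + 0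
mono-≢ʳ a b i j j≢b =
  ≡.trans (cong (λ x → if does (i ℕ.≟ a) ∧ x then + 1 else + 0) (dec-false (j ℕ.≟ b) j≢b))
          (cong (λ x → if x then + 1 else + 0) (∧-zeroʳ (does (i ℕ.≟ a))))

mono-≡ : ∀ a b → mono a b a b ≡ + 1
mono-≡ a b = cong₂ (λ x y → if x ∧ y then + 1 else + 0) (dec-true (a ℕ.≟ a) ≡.refl) (dec-true (b ℕ.≟ b) ≡.refl)

⊗-constant : ∀ X Y → (X ⊗ Y) 0 0 ≡ X 0 0 ℤ.* Y 0 0
⊗-constant X Y = ≡.trans (ℤP.+-identityˡ _) (ℤP.+-identityˡ _)

qPoch-constant : ∀ {r} → 1 ≤ r → ∀ n → qPoch r n 0 0 ≡ + 1
qPoch-constant 1≤r zero    = ≡.refl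
qPoch-constant {r} 1≤r (suc n) = begin
  (qPoch r n ⊗ (1S ⊖ mono 0 (r ℕ.* suc n))) 0 0  ≡⟨ ⊗-constant (qPoch r n) (1S ⊖ mono 0 (r ℕ.* suc n)) ⟩
  qPoch r n 0 0 ℤ.* (+ 1 ℤ.- mono 0 (r ℕ.* suc n) 0 0)
    ≡⟨ cong₂ (λ x y → x ℤ.* (+ 1 ℤ.- y)) (qPoch-constant 1≤r n) (mono-≢ʳ 0 (r ℕ.* suc n) 0 0 (ℕP.<⇒≢ (ℕP.*-mono-≤ 1≤r (s≤s z≤n)))) ⟩
  + 1 ∎
  where open ≡.≡-Reasoning

t^ : ℕ → Ser2
t^ c = mono c 0

qbinom : ℕ → ℕ → ℕ → Ser2
qbinom r n k = qPoch r n ⊗ inv (qPoch r (n ∸ k)) ⊗ inv (qPoch r k)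

Fcoef-suc : ∀ r n → Fcoef r (suc n) ≡ step r (Fupto r n) (suc n)
Fcoef-suc r n with suc n ℕ.≤? n
... | yes 1+n≤n = ⊥-elim (ℕP.<-irrefl ≡.refl 1+n≤n)
... | no  _     = ≡.refl

Fupto-stable : ∀ r n k → k ≤ n → Fupto r n k ≡ Fcoef r k
Fupto-stable r zero    zero z≤n = ≡.refl
Fupto-stable r (suc n) k k≤1+n with k ℕ.≤? n
... | yes k≤n = Fupto-stable r n k k≤n
... | no  k≰n rewrite ℕP.≤-antisym k≤1+n (ℕP.≰⇒> k≰n) = ≡.sym (Fcoef-suc r n)

Fcoef-step : ∀ r n → Fcoef r n ≈₂ step r (Fcoef r) n
Fcoef-step r zero    = Ser2.refl
Fcoef-step r (suc n) = Ser2.trans (Ser2.reflexive (Fcoef-suc r n))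
  (⊗-congˡ (inv (Den r 0)) (⊖-congˡ (Num r (suc n)) (sumS-cong (suc n) λ k k<1+n →
    ⊗-congʳ (Den r (suc n ∸ k)) (Ser2.reflexive (Fupto-stable r n k (ℕP.≤-pred k<1+n))))))

A-recurrence-term : ℕ → ℕ → ℕ → Ser2
A-recurrence-term r n k = qbinom r n k ⊗ A r k ⊗ (t^ (r ℕ.* (n ∸ k)) ⊖ t^ 1)

module _ {r : ℕ} (1≤r : 1 ≤ r) where

  open CommutativeRing Ser2-commutativeRing
  open import Relation.Binary.Reasoning.Setoid setoid
  open import Algebra.Properties.Ring ring using (x[y-z]≈xy-xz)
  open import Algebra.Properties.CommutativeSemigroup *-commutativeSemigroup using (x∙yz≈y∙xz; xy∙z≈x∙zy; interchange)

  private
    Q Q⁻¹ : ℕ → Ser2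
    Q n = qPoch r n
    Q⁻¹ n = inv (qPoch r n)

    Q⁻¹-inverseˡ : ∀ n → Q⁻¹ n ⊗ Q n ≈ 1S
    Q⁻¹-inverseˡ n = inv-inverseˡ (Q n) (qPoch-constant 1≤r n)

    Q⁻¹-inverseʳ : ∀ n → Q n ⊗ Q⁻¹ n ≈ 1S
    Q⁻¹-inverseʳ n = inv-inverseʳ (Q n) (qPoch-constant 1≤r n)

    Q⁻¹-cancelʳ : ∀ n X → X ⊗ Q⁻¹ n ⊗ Q n ≈ X
    Q⁻¹-cancelʳ n X = begin
      X ⊗ Q⁻¹ n ⊗ Q n    ≈⟨ *-assoc X (Q⁻¹ n) (Q n) ⟩
      X ⊗ (Q⁻¹ n ⊗ Q n)  ≈⟨ ⊗-congˡ X (Q⁻¹-inverseˡ n) ⟩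
      X ⊗ 1S             ≈⟨ *-identityʳ X ⟩
      X                  ∎

    Q-cancel : ∀ n X → Q n ⊗ (X ⊗ Q⁻¹ n) ≈ X
    Q-cancel n X = begin
      Q n ⊗ (X ⊗ Q⁻¹ n)  ≈⟨ x∙yz≈y∙xz (Q n) X (Q⁻¹ n) ⟩
      X ⊗ (Q n ⊗ Q⁻¹ n)  ≈⟨ ⊗-congˡ X (Q⁻¹-inverseʳ n) ⟩
      X ⊗ 1S             ≈⟨ *-identityʳ X ⟩
      X                  ∎

  qPoch-⊗-Num : ∀ n → qPoch r n ⊗ Num r n ≈ 1S ⊖ t^ (r ℕ.* n)
  qPoch-⊗-Num n = begin
    Q n ⊗ (Q⁻¹ n ⊖ t^ (r ℕ.* n) ⊗ Q⁻¹ n)           ≈⟨ x[y-z]≈xy-xz (Q n) (Q⁻¹ n) (t^ (r ℕ.* n) ⊗ Q⁻¹ n) ⟩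
    Q n ⊗ Q⁻¹ n ⊖ Q n ⊗ (t^ (r ℕ.* n) ⊗ Q⁻¹ n)     ≈⟨ ⊖-cong (Q⁻¹-inverseʳ n) (Q-cancel n (t^ (r ℕ.* n))) ⟩
    1S ⊖ t^ (r ℕ.* n)                             ∎

  qPoch-⊗-Den : ∀ n → qPoch r n ⊗ Den r n ≈ t^ (r ℕ.* n) ⊖ t^ 1
  qPoch-⊗-Den n = begin
    Q n ⊗ (t^ (r ℕ.* n) ⊗ Q⁻¹ n ⊖ t^ 1 ⊗ Q⁻¹ n)              ≈⟨ x[y-z]≈xy-xz (Q n) (t^ (r ℕ.* n) ⊗ Q⁻¹ n) (t^ 1 ⊗ Q⁻¹ n) ⟩
    Q n ⊗ (t^ (r ℕ.* n) ⊗ Q⁻¹ n) ⊖ Q n ⊗ (t^ 1 ⊗ Q⁻¹ n)      ≈⟨ ⊖-cong (Q-cancel n (t^ (r ℕ.* n))) (Q-cancel n (t^ 1)) ⟩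
    t^ (r ℕ.* n) ⊖ t^ 1                                      ∎

  Den₀≈1-t : Den r 0 ≈ 1S ⊖ t^ 1
  Den₀≈1-t = begin
    Den r 0              ≈⟨ *-identityˡ (Den r 0) ⟨
    1S ⊗ Den r 0         ≈⟨ qPoch-⊗-Den 0 ⟩
    t^ (r ℕ.* 0) ⊖ t^ 1  ≡⟨ cong (λ c → t^ c ⊖ t^ 1) (ℕP.*-zeroʳ r) ⟩
    1S ⊖ t^ 1            ∎

  private
    F : ℕ → Ser2
    F = Fcoef r

    convolution-below : ℕ → Ser2
    convolution-below n = sumS n (λ k → F k ⊗ Den r (n ∸ k))

  Den₀-⊗-Fcoef : ∀ n → Den r 0 ⊗ F n ≈ Num r n ⊖ convolution-below n
  Den₀-⊗-Fcoef n = begin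
    Den r 0 ⊗ F n                                        ≈⟨ ⊗-congˡ (Den r 0) (Fcoef-step r n) ⟩
    Den r 0 ⊗ (inv (Den r 0) ⊗ (Num r n ⊖ convolution-below n))
      ≈⟨ *-assoc (Den r 0) (inv (Den r 0)) (Num r n ⊖ convolution-below n) ⟨
    Den r 0 ⊗ inv (Den r 0) ⊗ (Num r n ⊖ convolution-below n)
      ≈⟨ ⊗-congʳ (Num r n ⊖ convolution-below n) (inv-inverseʳ (Den r 0) (at Den₀≈1-t 0 0)) ⟩
    1S ⊗ (Num r n ⊖ convolution-below n)                 ≈⟨ *-identityˡ (Num r n ⊖ convolution-below n) ⟩
    Num r n ⊖ convolution-below n                        ∎

  Fcoef-⊗-Den : ∀ n → sumS (suc n) (λ k → F k ⊗ Den r (n ∸ k)) ≈ Num r n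
  Fcoef-⊗-Den n = begin
    convolution-below n ⊕ F n ⊗ Den r (n ∸ n)            ≡⟨ cong (λ m → convolution-below n ⊕ F n ⊗ Den r m) (ℕP.n∸n≡0 n) ⟩
    convolution-below n ⊕ F n ⊗ Den r 0                  ≈⟨ ⊕-congˡ (convolution-below n) (*-comm (F n) (Den r 0)) ⟩
    convolution-below n ⊕ Den r 0 ⊗ F n                  ≈⟨ ⊕-congˡ (convolution-below n) (Den₀-⊗-Fcoef n) ⟩
    convolution-below n ⊕ (Num r n ⊖ convolution-below n) ≈⟨ coeffwise (λ a b → x+[y-x]≡y (convolution-below n a b) (Num r n a b)) ⟩
    Num r n                                              ∎
    where
    x+[y-x]≡y : ∀ x y → x ℤ.+ (y ℤ.- x) ≡ y
    x+[y-x]≡y = solve-∀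

  qbinom-⊗ : ∀ n k → qbinom r n k ⊗ Q k ⊗ Q (n ∸ k) ≈ Q n
  qbinom-⊗ n k = trans (⊗-congʳ (Q (n ∸ k)) (Q⁻¹-cancelʳ k (Q n ⊗ Q⁻¹ (n ∸ k)))) (Q⁻¹-cancelʳ (n ∸ k) (Q n))

  qPoch-⊗-convolution-term : ∀ n k → Q n ⊗ (F k ⊗ Den r (n ∸ k)) ≈ A-recurrence-term r n k
  qPoch-⊗-convolution-term n k = begin
    Q n ⊗ (F k ⊗ Den r m)                          ≈⟨ ⊗-congʳ (F k ⊗ Den r m) (qbinom-⊗ n k) ⟨
    qbinom r n k ⊗ Q k ⊗ Q m ⊗ (F k ⊗ Den r m)     ≈⟨ interchange (qbinom r n k ⊗ Q k) (Q m) (F k) (Den r m) ⟩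
    qbinom r n k ⊗ Q k ⊗ F k ⊗ (Q m ⊗ Den r m)     ≈⟨ ⊗-congʳ (Q m ⊗ Den r m) (xy∙z≈x∙zy (qbinom r n k) (Q k) (F k)) ⟩
    qbinom r n k ⊗ A r k ⊗ (Q m ⊗ Den r m)        ≈⟨ ⊗-congˡ (qbinom r n k ⊗ A r k) (qPoch-⊗-Den m) ⟩
    qbinom r n k ⊗ A r k ⊗ (t^ (r ℕ.* m) ⊖ t^ 1)  ∎
    where m = n ∸ k

  A-recurrence : ∀ n → sumS (suc n) (A-recurrence-term r n) ≈ 1S ⊖ t^ (r ℕ.* n)
  A-recurrence n = begin
    sumS (suc n) (A-recurrence-term r n)              ≈⟨ sumS-cong (suc n) (λ k _ → qPoch-⊗-convolution-term n k) ⟨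
    sumS (suc n) (λ k → Q n ⊗ (F k ⊗ Den r (n ∸ k)))  ≈⟨ sumS-distribˡ (suc n) (Q n) (λ k → F k ⊗ Den r (n ∸ k)) ⟨
    Q n ⊗ sumS (suc n) (λ k → F k ⊗ Den r (n ∸ k))   ≈⟨ ⊗-congˡ (Q n) (Fcoef-⊗-Den n) ⟩
    Q n ⊗ Num r n                                    ≈⟨ qPoch-⊗-Num n ⟩
    1S ⊖ t^ (r ℕ.* n)                                ∎

  qbinom-diagonal : ∀ n → qbinom r n n ≈ 1S
  qbinom-diagonal n = begin
    Q n ⊗ inv (Q (n ∸ n)) ⊗ Q⁻¹ n  ≡⟨ cong (λ m → Q n ⊗ inv (Q m) ⊗ Q⁻¹ n) (ℕP.n∸n≡0 n) ⟩
    Q n ⊗ inv 1S ⊗ Q⁻¹ n           ≈⟨ ⊗-congʳ (Q⁻¹ n) (⊗-congˡ (Q n) inv-1S) ⟩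
    Q n ⊗ 1S ⊗ Q⁻¹ n               ≈⟨ ⊗-congʳ (Q⁻¹ n) (*-identityʳ (Q n)) ⟩
    Q n ⊗ Q⁻¹ n                    ≈⟨ Q⁻¹-inverseʳ n ⟩
    1S                             ∎
    where
    inv-1S : inv 1S ≈ 1S
    inv-1S = trans (sym (*-identityʳ (inv 1S))) (inv-inverseˡ 1S ≡.refl)

  A-recurrence-term-diagonal : ∀ n → A-recurrence-term r n n ≈ A r n ⊗ (1S ⊖ t^ 1)
  A-recurrence-term-diagonal n = begin
    qbinom r n n ⊗ A r n ⊗ (t^ (r ℕ.* (n ∸ n)) ⊖ t^ 1)  ≡⟨ cong (λ c → qbinom r n n ⊗ A r n ⊗ (t^ c ⊖ t^ 1)) r*[n∸n]≡0 ⟩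
    qbinom r n n ⊗ A r n ⊗ (1S ⊖ t^ 1)                 ≈⟨ ⊗-congʳ (1S ⊖ t^ 1) (⊗-congʳ (A r n) (qbinom-diagonal n)) ⟩
    1S ⊗ A r n ⊗ (1S ⊖ t^ 1)                           ≈⟨ ⊗-congʳ (1S ⊖ t^ 1) (*-identityˡ (A r n)) ⟩
    A r n ⊗ (1S ⊖ t^ 1)                                ∎
    where
    r*[n∸n]≡0 : r ℕ.* (n ∸ n) ≡ 0
    r*[n∸n]≡0 = ≡.trans (cong (r ℕ.*_) (ℕP.n∸n≡0 n)) (ℕP.*-zeroʳ r)

  A-⊗-[1-t] : ∀ n → A r n ⊗ (1S ⊖ t^ 1) ≈ (1S ⊖ t^ (r ℕ.* n)) ⊖ sumS n (A-recurrence-term r n)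
  A-⊗-[1-t] n = begin
    A r n ⊗ (1S ⊖ t^ 1)                      ≈⟨ A-recurrence-term-diagonal n ⟨
    A-recurrence-term r n n                  ≈⟨ coeffwise (λ a b → y≡[x+y]-x (S a b) (A-recurrence-term r n n a b)) ⟩
    sumS (suc n) (A-recurrence-term r n) ⊖ S  ≈⟨ ⊖-congʳ S (A-recurrence n) ⟩
    (1S ⊖ t^ (r ℕ.* n)) ⊖ S                  ∎
    where
    S = sumS n (A-recurrence-term r n)
    y≡[x+y]-x : ∀ x y → y ≡ (x ℤ.+ y) ℤ.- x
    y≡[x+y]-x = solve-∀

coeff : Ser2 → ℤ → ℕ → ℤ
coeff X (+ m)    j = X m j
coeff X -[1+ m ] j = + 0

Acoef≡coeff : ∀ r k m j → Acoef r k m j ≡ coeff (A r k) m j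
Acoef≡coeff r k (+ m)    j = ≡.refl
Acoef≡coeff r k -[1+ m ] j = ≡.refl

coeff-cong : ∀ {X Y} → X ≈₂ Y → ∀ m j → coeff X m j ≡ coeff Y m j
coeff-cong X≈Y (+ m)    j = at X≈Y m j
coeff-cong X≈Y -[1+ m ] j = ≡.refl

coeff-⊖ : ∀ X Y m j → coeff (X ⊖ Y) m j ≡ coeff X m j ℤ.- coeff Y m j
coeff-⊖ X Y (+ m)    j = ≡.refl
coeff-⊖ X Y -[1+ m ] j = ≡.refl

coeff-sumS : ∀ n F m j → coeff (sumS n F) m j ≡ sumTo n (λ k → coeff (F k) m j)
coeff-sumS n F (+ m)    j = ≡.refl
coeff-sumS n F -[1+ m ] j = ≡.sym (sumTo-zero n λ _ _ → ≡.refl)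

coeff-1S-neg : ∀ m j → coeff 1S (ℤ.- m) j ≡ coeff 1S m j
coeff-1S-neg (+ zero)    j = ≡.refl
coeff-1S-neg (+ suc m)   j = ≡.refl
coeff-1S-neg -[1+ m ]    j = ≡.refl

module _ (X : Ser2) (c : ℕ) where

  private
    row : ℕ → ℕ → ℕ → ℤ
    row a j i = sumTo (suc j) (λ b → X i b ℤ.* mono c 0 (a ∸ i) (j ∸ b))

  ⊗-t^-coeff-≥ : ∀ {a} j → c ≤ a → (X ⊗ t^ c) a j ≡ X (a ∸ c) j
  ⊗-t^-coeff-≥ {a} j c≤a = begin
    sumTo (suc a) (row a j)
      ≡⟨ sumTo-single (suc a) (row a j) (a ∸ c) (s≤s (ℕP.m∸n≤m a c)) other-row ⟩
    row a j (a ∸ c)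
      ≡⟨ sumTo-single (suc j) (λ b → X (a ∸ c) b ℤ.* mono c 0 (a ∸ (a ∸ c)) (j ∸ b)) j ℕP.≤-refl other-column ⟩
    X (a ∸ c) j ℤ.* mono c 0 (a ∸ (a ∸ c)) (j ∸ j)
      ≡⟨ cong₂ (λ u v → X (a ∸ c) j ℤ.* mono c 0 u v) (ℕP.m∸[m∸n]≡n c≤a) (ℕP.n∸n≡0 j) ⟩
    X (a ∸ c) j ℤ.* mono c 0 c 0
      ≡⟨ cong (X (a ∸ c) j ℤ.*_) (mono-≡ c 0) ⟩
    X (a ∸ c) j ℤ.* + 1
      ≡⟨ ℤP.*-identityʳ (X (a ∸ c) j) ⟩
    X (a ∸ c) j ∎
    where
    open ≡.≡-Reasoning
    other-row : ∀ i → i < suc a → i ≢ a ∸ c → row a j i ≡ + 0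
    other-row i i≤a i≢a∸c = sumTo-zero (suc j) λ b _ →
      ≡.trans (cong (X i b ℤ.*_) (mono-≢ˡ c 0 (a ∸ i) (j ∸ b) a∸i≢c)) (ℤP.*-zeroʳ (X i b))
      where
      a∸i≢c : a ∸ i ≢ c
      a∸i≢c a∸i≡c = i≢a∸c (≡.trans (≡.sym (ℕP.m∸[m∸n]≡n (ℕP.≤-pred i≤a))) (cong (a ∸_) a∸i≡c))
    other-column : ∀ b → b < suc j → b ≢ j → X (a ∸ c) b ℤ.* mono c 0 (a ∸ (a ∸ c)) (j ∸ b) ≡ + 0
    other-column b b≤j b≢j = ≡.trans (cong (X (a ∸ c) b ℤ.*_) (mono-≢ʳ c 0 (a ∸ (a ∸ c)) (j ∸ b) j∸b≢0)) (ℤP.*-zeroʳ (X (a ∸ c) b))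
      where
      j∸b≢0 : j ∸ b ≢ 0
      j∸b≢0 j∸b≡0 = b≢j (ℕP.≤-antisym (ℕP.≤-pred b≤j) (ℕP.m∸n≡0⇒m≤n j∸b≡0))

  ⊗-t^-coeff-< : ∀ {a} j → a < c → (X ⊗ t^ c) a j ≡ + 0
  ⊗-t^-coeff-< {a} j a<c = sumTo-zero (suc a) λ i i≤a → sumTo-zero (suc j) λ b _ →
    ≡.trans (cong (X i b ℤ.*_) (mono-≢ˡ c 0 (a ∸ i) (j ∸ b) (a∸i≢c i))) (ℤP.*-zeroʳ (X i b))
    where
    a∸i≢c : ∀ i → a ∸ i ≢ c
    a∸i≢c i a∸i≡c = ℕP.<⇒≱ a<c (≡.subst (_≤ a) a∸i≡c (ℕP.m∸n≤m a i))

coeff-⊗-t^ : ∀ X c m j → coeff (X ⊗ t^ c) m j ≡ coeff X (m ℤ.- + c) j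
coeff-⊗-t^ X c -[1+ m ] j = ≡.sym (below-zero c)
  where
  below-zero : ∀ c → coeff X (-[1+ m ] ℤ.- + c) j ≡ + 0
  below-zero zero    = ≡.refl
  below-zero (suc c) = ≡.refl
coeff-⊗-t^ X c (+ a) j with c ℕ.≤? a
... | yes c≤a = ≡.trans (⊗-t^-coeff-≥ X c j c≤a)
      (cong (λ z → coeff X z j) (≡.sym (≡.trans (ℤP.[+m]-[+n]≡m⊖n a c) (ℤP.⊖-≥ c≤a))))
... | no  c≰a = ≡.trans (⊗-t^-coeff-< X c j a<c) (≡.sym (≡.trans
      (cong (λ z → coeff X z j) (≡.trans (ℤP.[+m]-[+n]≡m⊖n a c) (ℤP.⊖-< a<c)))
      (negative (c ∸ a) (ℕP.m>n⇒m∸n≢0 a<c))))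
  where
  a<c = ℕP.≰⇒> c≰a
  negative : ∀ k → k ≢ 0 → coeff X (ℤ.- (+ k)) j ≡ + 0
  negative zero    k≢0 = ⊥-elim (k≢0 ≡.refl)
  negative (suc k) _   = ≡.refl

record TFree (X : Ser2) : Set where
  constructor t-free
  field vanishes : ∀ a b → X (suc a) b ≡ + 0
open TFree

TFree-⊗ : ∀ {X Y} → TFree X → TFree Y → TFree (X ⊗ Y)
TFree-⊗ {X} {Y} X-free Y-free = t-free λ a b → sumTo-zero (suc (suc a)) λ i _ → sumTo-zero (suc b) λ j _ → term a b i j
  where
  term : ∀ a b i j → X i j ℤ.* Y (suc a ∸ i) (b ∸ j) ≡ + 0
  term a b zero    j = ≡.trans (cong (X 0 j ℤ.*_) (vanishes Y-free a (b ∸ j))) (ℤP.*-zeroʳ (X 0 j))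
  term a b (suc i) j = ≡.trans (cong (ℤ._* Y (a ∸ i) (b ∸ j)) (vanishes X-free i j)) (ℤP.*-zeroˡ (Y (a ∸ i) (b ∸ j)))

TFree-⊖ : ∀ {X Y} → TFree X → TFree Y → TFree (X ⊖ Y)
TFree-⊖ X-free Y-free = t-free λ a b → cong₂ ℤ._-_ (vanishes X-free a b) (vanishes Y-free a b)

TFree-1S : TFree 1S
TFree-1S = t-free λ _ _ → ≡.refl

TFree-q^ : ∀ c → TFree (mono 0 c)
TFree-q^ c = t-free λ _ _ → ≡.refl

TFree-pow : ∀ {X} → TFree X → ∀ m → TFree (pow X m)
TFree-pow X-free zero    = TFree-1S
TFree-pow X-free (suc m) = TFree-⊗ (TFree-pow X-free m) X-free

TFree-inv : ∀ {X} → TFree X → TFree (inv X)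
TFree-inv X-free = t-free λ a b → sumTo-zero (suc (suc a ℕ.+ b)) λ m _ →
  vanishes (TFree-pow (TFree-⊖ TFree-1S X-free) m) a b

TFree-qPoch : ∀ r n → TFree (qPoch r n)
TFree-qPoch r zero    = TFree-1S
TFree-qPoch r (suc n) = TFree-⊗ (TFree-qPoch r n) (TFree-⊖ TFree-1S (TFree-q^ (r ℕ.* suc n)))

TFree-qbinom : ∀ r n k → TFree (qbinom r n k)
TFree-qbinom r n k =
  TFree-⊗ (TFree-⊗ (TFree-qPoch r n) (TFree-inv (TFree-qPoch r (n ∸ k)))) (TFree-inv (TFree-qPoch r k))

qconv-cong : ∀ {f f′ g g′} j → (∀ b → f b ≡ f′ b) → (∀ b → g b ≡ g′ b) → qconv f g j ≡ qconv f′ g′ j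
qconv-cong j f≡f′ g≡g′ = sumTo-cong (suc j) λ b _ → cong₂ ℤ._*_ (f≡f′ b) (g≡g′ (j ∸ b))

coeff-TFree-⊗ : ∀ {Y} Z → TFree Y → ∀ m j → coeff (Y ⊗ Z) m j ≡ qconv (Y 0) (coeff Z m) j
coeff-TFree-⊗ {Y} Z Y-free (+ a) j =
  sumTo-single (suc a) (λ i → sumTo (suc j) λ b → Y i b ℤ.* Z (a ∸ i) (j ∸ b)) 0 (s≤s z≤n) λ
    { zero    _ 0≢0 → ⊥-elim (0≢0 ≡.refl)
    ; (suc i) _ _   → sumTo-zero (suc j) λ b _ →
        ≡.trans (cong (ℤ._* Z (a ∸ suc i) (j ∸ b)) (vanishes Y-free i b)) (ℤP.*-zeroˡ (Z (a ∸ suc i) (j ∸ b)))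
    }
coeff-TFree-⊗ {Y} Z Y-free -[1+ m ] j = ≡.sym (sumTo-zero (suc j) λ b _ → ℤP.*-zeroʳ (Y 0 b))

-- Reflection symmetry of integer sequences

SymmetricAbout : ℤ → (ℤ → ℤ) → Set
SymmetricAbout c u = ∀ m → u (c ℤ.- m) ≡ u m

AntisymmetricAbout : ℤ → (ℤ → ℤ) → Set
AntisymmetricAbout c v = ∀ m → v (c ℤ.- m) ≡ ℤ.- v m

symmetric-cong : ∀ {c u w} → (∀ m → u m ≡ w m) → SymmetricAbout c u → SymmetricAbout c w
symmetric-cong {c} u≡w u-sym m = ≡.trans (≡.sym (u≡w (c ℤ.- m))) (≡.trans (u-sym m) (u≡w m))

antisymmetric-cong : ∀ {c v w} → (∀ m → v m ≡ w m) → AntisymmetricAbout c v → AntisymmetricAbout c w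
antisymmetric-cong {c} v≡w v-anti m = ≡.trans (≡.sym (v≡w (c ℤ.- m))) (≡.trans (v-anti m) (cong ℤ.-_ (v≡w m)))

antisymmetric-− : ∀ {c v w} → AntisymmetricAbout c v → AntisymmetricAbout c w →
  AntisymmetricAbout c (λ m → v m ℤ.- w m)
antisymmetric-− {v = v} {w} v-anti w-anti m =
  ≡.trans (cong₂ ℤ._-_ (v-anti m) (w-anti m)) (-x-[-y]≡-[x-y] (v m) (w m))
  where
  -x-[-y]≡-[x-y] : ∀ x y → ℤ.- x ℤ.- ℤ.- y ≡ ℤ.- (x ℤ.- y)
  -x-[-y]≡-[x-y] = solve-∀

antisymmetric-sumTo : ∀ {c} n {v : ℕ → ℤ → ℤ} → (∀ k → k < n → AntisymmetricAbout c (v k)) →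
  AntisymmetricAbout c (λ m → sumTo n (λ k → v k m))
antisymmetric-sumTo zero    v-anti m = ≡.refl
antisymmetric-sumTo {c} (suc n) {v} v-anti m =
  ≡.trans (cong₂ ℤ._+_ (antisymmetric-sumTo {c} n (λ k k<n → v-anti k (ℕP.m<n⇒m<1+n k<n)) m) (v-anti n ℕP.≤-refl m))
          (≡.sym (ℤP.neg-distrib-+ (sumTo n (λ k → v k m)) (v n m)))

difference-of-shifts-antisymmetric : ∀ {c} s s′ {b} → SymmetricAbout c b →
  AntisymmetricAbout (c ℤ.+ s ℤ.+ s′) (λ m → b (m ℤ.- s) ℤ.- b (m ℤ.- s′))
difference-of-shifts-antisymmetric {c} s s′ {b} b-sym m = begin
  b (c ℤ.+ s ℤ.+ s′ ℤ.- m ℤ.- s) ℤ.- b (c ℤ.+ s ℤ.+ s′ ℤ.- m ℤ.- s′)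
    ≡⟨ cong₂ (λ x y → b x ℤ.- b y) (reflect-s′ c s s′ m) (reflect-s c s s′ m) ⟩
  b (c ℤ.- (m ℤ.- s′)) ℤ.- b (c ℤ.- (m ℤ.- s))
    ≡⟨ cong₂ ℤ._-_ (b-sym (m ℤ.- s′)) (b-sym (m ℤ.- s)) ⟩
  b (m ℤ.- s′) ℤ.- b (m ℤ.- s)
    ≡⟨ y-x≡-[x-y] (b (m ℤ.- s)) (b (m ℤ.- s′)) ⟩
  ℤ.- (b (m ℤ.- s) ℤ.- b (m ℤ.- s′)) ∎
  where
  open ≡.≡-Reasoning
  reflect-s′ : ∀ c s s′ m → c ℤ.+ s ℤ.+ s′ ℤ.- m ℤ.- s ≡ c ℤ.- (m ℤ.- s′)
  reflect-s′ = solve-∀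
  reflect-s : ∀ c s s′ m → c ℤ.+ s ℤ.+ s′ ℤ.- m ℤ.- s′ ≡ c ℤ.- (m ℤ.- s)
  reflect-s = solve-∀
  y-x≡-[x-y] : ∀ x y → y ℤ.- x ≡ ℤ.- (x ℤ.- y)
  y-x≡-[x-y] = solve-∀

shift-invariant⇒constant : ∀ {d : ℤ → ℤ} → (∀ m → d m ≡ d (m ℤ.- + 1)) → ∀ m → d m ≡ d (+ 0)
shift-invariant⇒constant         d-inv (+ zero)       = ≡.refl
shift-invariant⇒constant {d} d-inv (+ suc m)     =
  ≡.trans (d-inv (+ suc m)) (≡.trans (cong d (≡.trans (ℤP.[1+m]⊖[1+n]≡m⊖n m 0) (ℤP.⊖-≥ z≤n))) (shift-invariant⇒constant d-inv (+ m)))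
shift-invariant⇒constant         d-inv -[1+ zero ]    = ≡.sym (d-inv (+ 0))
shift-invariant⇒constant {d} d-inv -[1+ suc m ]  =
  ≡.trans (cong d (≡.sym (ℤP.neg-minus-pos m 1))) (≡.trans (≡.sym (d-inv -[1+ m ])) (shift-invariant⇒constant d-inv -[1+ m ]))

symmetric-if-differences-antisymmetric : ∀ {N u v} →
  (∀ m → u m ℤ.- u (m ℤ.- + 1) ≡ v m) → AntisymmetricAbout N v → SymmetricAbout (N ℤ.- + 1) u
symmetric-if-differences-antisymmetric {N} {u} {v} Δu≡v v-anti m =
  ≡.sym (ℤP.i-j≡0⇒i≡j (u m) (u (c ℤ.- m)) (≡.trans (shift-invariant⇒constant d-invariant m) d₀≡0))
  where
  open ≡.≡-Reasoning
  c = N ℤ.- + 1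

  d : ℤ → ℤ
  d m = u m ℤ.- u (c ℤ.- m)

  d-invariant : ∀ m → d m ≡ d (m ℤ.- + 1)
  d-invariant m = begin
    u m ℤ.- u (c ℤ.- m)
      ≡⟨ telescope (u m) (u (m ℤ.- + 1)) (u (N ℤ.- m)) (u (c ℤ.- m)) ⟩
    (u m ℤ.- u (m ℤ.- + 1)) ℤ.+ (u (m ℤ.- + 1) ℤ.- u (N ℤ.- m)) ℤ.+ (u (N ℤ.- m) ℤ.- u (c ℤ.- m))
      ≡⟨ cong₂ (λ x y → x ℤ.+ (u (m ℤ.- + 1) ℤ.- u (N ℤ.- m)) ℤ.+ y) (Δu≡v m) Δu[N-m]≡-v[m] ⟩
    v m ℤ.+ (u (m ℤ.- + 1) ℤ.- u (N ℤ.- m)) ℤ.+ ℤ.- v m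
      ≡⟨ x+y-x≡y (v m) _ ⟩
    u (m ℤ.- + 1) ℤ.- u (N ℤ.- m)
      ≡⟨ cong (λ x → u (m ℤ.- + 1) ℤ.- u x) (N-m≡c-[m-1] N m) ⟩
    u (m ℤ.- + 1) ℤ.- u (c ℤ.- (m ℤ.- + 1)) ∎
    where
    telescope : ∀ a b c d → a ℤ.- d ≡ (a ℤ.- b) ℤ.+ (b ℤ.- c) ℤ.+ (c ℤ.- d)
    telescope = solve-∀
    x+y-x≡y : ∀ x y → x ℤ.+ y ℤ.+ ℤ.- x ≡ y
    x+y-x≡y = solve-∀
    c-m≡N-m-1 : ∀ N m → N ℤ.- + 1 ℤ.- m ≡ N ℤ.- m ℤ.- + 1
    c-m≡N-m-1 = solve-∀
    N-m≡c-[m-1] : ∀ N m → N ℤ.- m ≡ N ℤ.- + 1 ℤ.- (m ℤ.- + 1)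
    N-m≡c-[m-1] = solve-∀
    Δu[N-m]≡-v[m] : u (N ℤ.- m) ℤ.- u (c ℤ.- m) ≡ ℤ.- v m
    Δu[N-m]≡-v[m] = ≡.trans (cong (λ x → u (N ℤ.- m) ℤ.- u x) (c-m≡N-m-1 N m)) (≡.trans (Δu≡v (N ℤ.- m)) (v-anti m))

  d-antisymmetric : AntisymmetricAbout c d
  d-antisymmetric m = begin
    u (c ℤ.- m) ℤ.- u (c ℤ.- (c ℤ.- m))  ≡⟨ cong (λ x → u (c ℤ.- m) ℤ.- u x) (c-[c-m]≡m c m) ⟩
    u (c ℤ.- m) ℤ.- u m                  ≡⟨ y-x≡-[x-y] (u m) (u (c ℤ.- m)) ⟩
    ℤ.- (u m ℤ.- u (c ℤ.- m))            ∎
    where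
    c-[c-m]≡m : ∀ c m → c ℤ.- (c ℤ.- m) ≡ m
    c-[c-m]≡m = solve-∀
    y-x≡-[x-y] : ∀ x y → y ℤ.- x ≡ ℤ.- (x ℤ.- y)
    y-x≡-[x-y] = solve-∀

  d₀≡0 : d (+ 0) ≡ + 0
  d₀≡0 = x≡-x⇒x≡0 (begin
    d (+ 0)              ≡⟨ shift-invariant⇒constant d-invariant (c ℤ.- + 0) ⟨
    d (c ℤ.- + 0)        ≡⟨ d-antisymmetric (+ 0) ⟩
    ℤ.- d (+ 0)          ∎)
    where
    x≡-x⇒x≡0 : ∀ {x} → x ≡ ℤ.- x → x ≡ + 0
    x≡-x⇒x≡0 {+ zero}   _  = ≡.refl
    x≡-x⇒x≡0 {+ suc _}  ()
    x≡-x⇒x≡0 { -[1+ _ ]} ()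

-- Palindromicity of A

Palindromic : ℕ → Ser2 → Set
Palindromic d X = ∀ j → SymmetricAbout (+ d ℤ.- + 1) (λ m → coeff X m j)

TFree-⊗-palindromic : ∀ {d Y X} → TFree Y → Palindromic d X → Palindromic d (Y ⊗ X)
TFree-⊗-palindromic {d} {Y} {X} Y-free X-pal j =
  symmetric-cong {+ d ℤ.- + 1} (λ m → ≡.sym (coeff-TFree-⊗ X Y-free m j))
    (λ m → qconv-cong {Y 0} {Y 0} j (λ _ → ≡.refl) (λ b → X-pal b m))

coeff-⊗-t^-difference : ∀ Y s s′ m j →
  coeff (Y ⊗ (t^ s ⊖ t^ s′)) m j ≡ coeff Y (m ℤ.- + s) j ℤ.- coeff Y (m ℤ.- + s′) j
coeff-⊗-t^-difference Y s s′ m j = ≡.trans (coeff-cong (x[y-z]≈xy-xz Y (t^ s) (t^ s′)) m j)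
  (≡.trans (coeff-⊖ (Y ⊗ t^ s) (Y ⊗ t^ s′) m j) (cong₂ ℤ._-_ (coeff-⊗-t^ Y s m j) (coeff-⊗-t^ Y s′ m j)))
  where open import Algebra.Properties.Ring Ser2.ring using (x[y-z]≈xy-xz)

⊗-t^-difference-antisymmetric : ∀ {c} Y s s′ j → SymmetricAbout c (λ m → coeff Y m j) →
  AntisymmetricAbout (c ℤ.+ + s ℤ.+ + s′) (λ m → coeff (Y ⊗ (t^ s ⊖ t^ s′)) m j)
⊗-t^-difference-antisymmetric {c} Y s s′ j Y-sym =
  antisymmetric-cong {c ℤ.+ + s ℤ.+ + s′} (λ m → ≡.sym (coeff-⊗-t^-difference Y s s′ m j))
    (difference-of-shifts-antisymmetric {c} (+ s) (+ s′) Y-sym)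

r*k+r*[n∸k]≡r*n : ∀ r {n k} → k ≤ n → r ℕ.* k ℕ.+ r ℕ.* (n ∸ k) ≡ r ℕ.* n
r*k+r*[n∸k]≡r*n r {n} {k} k≤n = ≡.trans (≡.sym (ℕP.*-distribˡ-+ r k (n ∸ k))) (cong (r ℕ.*_) (ℕP.m+[n∸m]≡n k≤n))

module _ {r : ℕ} (1≤r : 1 ≤ r) where

  open ≡.≡-Reasoning

  A-recurrence-term-antisymmetric : ∀ n k → k ≤ n → Palindromic (r ℕ.* k) (A r k) →
    ∀ j → AntisymmetricAbout (+ (r ℕ.* n)) (λ m → coeff (A-recurrence-term r n k) m j)
  A-recurrence-term-antisymmetric n k k≤n A-pal j =
    ≡.subst (λ N → AntisymmetricAbout N (λ m → coeff (A-recurrence-term r n k) m j)) centre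
      (⊗-t^-difference-antisymmetric {+ (r ℕ.* k) ℤ.- + 1} (qbinom r n k ⊗ A r k) (r ℕ.* (n ∸ k)) 1 j
        (TFree-⊗-palindromic {r ℕ.* k} (TFree-qbinom r n k) A-pal j))
    where
    K-1+S+1≡K+S : ∀ K S → K ℤ.- + 1 ℤ.+ S ℤ.+ + 1 ≡ K ℤ.+ S
    K-1+S+1≡K+S = solve-∀
    centre : + (r ℕ.* k) ℤ.- + 1 ℤ.+ + (r ℕ.* (n ∸ k)) ℤ.+ + 1 ≡ + (r ℕ.* n)
    centre = ≡.trans (K-1+S+1≡K+S (+ (r ℕ.* k)) (+ (r ℕ.* (n ∸ k)))) (cong +_ (r*k+r*[n∸k]≡r*n r k≤n))

  A-differences : ∀ n m j → coeff (A r n) m j ℤ.- coeff (A r n) (m ℤ.- + 1) j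
    ≡ coeff ((1S ⊖ t^ (r ℕ.* n)) ⊖ sumS n (A-recurrence-term r n)) m j
  A-differences n m j = begin
    coeff (A r n) m j ℤ.- coeff (A r n) (m ℤ.- + 1) j
      ≡⟨ cong (λ x → coeff (A r n) x j ℤ.- coeff (A r n) (m ℤ.- + 1) j) (ℤP.+-identityʳ m) ⟨
    coeff (A r n) (m ℤ.- + 0) j ℤ.- coeff (A r n) (m ℤ.- + 1) j
      ≡⟨ coeff-⊗-t^-difference (A r n) 0 1 m j ⟨
    coeff (A r n ⊗ (1S ⊖ t^ 1)) m j
      ≡⟨ coeff-cong (A-⊗-[1-t] 1≤r n) m j ⟩
    coeff ((1S ⊖ t^ (r ℕ.* n)) ⊖ sumS n (A-recurrence-term r n)) m j ∎

  remainder-antisymmetric : ∀ n → (∀ k → k < n → Palindromic (r ℕ.* k) (A r k)) →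
    ∀ j → AntisymmetricAbout (+ (r ℕ.* n)) (λ m → coeff ((1S ⊖ t^ (r ℕ.* n)) ⊖ sumS n (A-recurrence-term r n)) m j)
  remainder-antisymmetric n IH j =
    antisymmetric-cong {+ (r ℕ.* n)} (λ m → ≡.sym (≡.trans
        (coeff-⊖ (1S ⊖ t^ (r ℕ.* n)) (sumS n (A-recurrence-term r n)) m j)
        (cong₂ ℤ._-_ (coeff-cong (Ser2.sym (Ser2.*-identityˡ (1S ⊖ t^ (r ℕ.* n)))) m j)
                     (coeff-sumS n (A-recurrence-term r n) m j))))
      (antisymmetric-− {+ (r ℕ.* n)}
        (⊗-t^-difference-antisymmetric {+ 0} 1S 0 (r ℕ.* n) j 1S-symmetric)
        (antisymmetric-sumTo {+ (r ℕ.* n)} n λ k k<n →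
          A-recurrence-term-antisymmetric n k (ℕP.<⇒≤ k<n) (IH k k<n) j))
    where
    1S-symmetric : SymmetricAbout (+ 0) (λ m → coeff 1S m j)
    1S-symmetric m = ≡.trans (cong (λ x → coeff 1S x j) (ℤP.+-identityˡ (ℤ.- m))) (coeff-1S-neg m j)

  A-palindromic : ∀ n → Palindromic (r ℕ.* n) (A r n)
  A-palindromic = <-rec _ λ n IH j →
    symmetric-if-differences-antisymmetric {+ (r ℕ.* n)} {λ m → coeff (A r n) m j}
      (λ m → A-differences n m j) (remainder-antisymmetric n (λ k → IH {k}) j)

qbinom-A-sum : ℕ → ℕ → ℤ → ℕ → ℤ
qbinom-A-sum r n x j = sumTo (suc n) (λ k → qconv (qbinom r n k 0) (coeff (A r k) x) j)

qbinom-A-sum-reflection : ∀ {r} → 1 ≤ r → ∀ n m j →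
  qbinom-A-sum r n (+ (r ℕ.* n) ℤ.- + 1 ℤ.- m) j ℤ.- qbinom-A-sum r n (m ℤ.- + 1) j ≡ coeff (1S ⊖ t^ (r ℕ.* n)) m j
qbinom-A-sum-reflection {r} 1≤r n m j = begin
  qbinom-A-sum r n (N ℤ.- + 1 ℤ.- m) j ℤ.- qbinom-A-sum r n (m ℤ.- + 1) j
    ≡⟨ sumTo-distrib-− (suc n) (λ k → b k (N ℤ.- + 1 ℤ.- m)) (λ k → b k (m ℤ.- + 1)) ⟨
  sumTo (suc n) (λ k → b k (N ℤ.- + 1 ℤ.- m) ℤ.- b k (m ℤ.- + 1))
    ≡⟨ sumTo-cong (suc n) (λ k k≤n → cong (ℤ._- b k (m ℤ.- + 1)) (b-reflection k (ℕP.≤-pred k≤n))) ⟩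
  sumTo (suc n) (λ k → b k (m ℤ.- + (r ℕ.* (n ∸ k))) ℤ.- b k (m ℤ.- + 1))
    ≡⟨ sumTo-cong (suc n) (λ k _ → term-coeff k) ⟨
  sumTo (suc n) (λ k → coeff (A-recurrence-term r n k) m j)
    ≡⟨ coeff-sumS (suc n) (A-recurrence-term r n) m j ⟨
  coeff (sumS (suc n) (A-recurrence-term r n)) m j
    ≡⟨ coeff-cong (A-recurrence 1≤r n) m j ⟩
  coeff (1S ⊖ t^ (r ℕ.* n)) m j ∎
  where
  open ≡.≡-Reasoning
  N = + (r ℕ.* n)

  b : ℕ → ℤ → ℤ
  b k x = qconv (qbinom r n k 0) (coeff (A r k) x) j

  term-coeff : ∀ k → coeff (A-recurrence-term r n k) m j ≡ b k (m ℤ.- + (r ℕ.* (n ∸ k))) ℤ.- b k (m ℤ.- + 1)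
  term-coeff k = ≡.trans (coeff-⊗-t^-difference (qbinom r n k ⊗ A r k) (r ℕ.* (n ∸ k)) 1 m j)
    (cong₂ ℤ._-_ (coeff-TFree-⊗ (A r k) (TFree-qbinom r n k) (m ℤ.- + (r ℕ.* (n ∸ k))) j)
                 (coeff-TFree-⊗ (A r k) (TFree-qbinom r n k) (m ℤ.- + 1) j))

  K+S-1-m≡K-1-[m-S] : ∀ K S m → K ℤ.+ S ℤ.- + 1 ℤ.- m ≡ K ℤ.- + 1 ℤ.- (m ℤ.- S)
  K+S-1-m≡K-1-[m-S] = solve-∀

  -- Palindromicity of A_k turns the k-dependent shift by r (n - k) into the reflection
  -- m ↦ rn - 1 - m, which is the same for every k.
  b-reflection : ∀ k → k ≤ n → b k (N ℤ.- + 1 ℤ.- m) ≡ b k (m ℤ.- + (r ℕ.* (n ∸ k)))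
  b-reflection k k≤n = qconv-cong {qbinom r n k 0} j (λ _ → ≡.refl) λ q → begin
    coeff (A r k) (N ℤ.- + 1 ℤ.- m) q
      ≡⟨ cong (λ N → coeff (A r k) (+ N ℤ.- + 1 ℤ.- m) q) (r*k+r*[n∸k]≡r*n r k≤n) ⟨
    coeff (A r k) (+ (r ℕ.* k) ℤ.+ + (r ℕ.* (n ∸ k)) ℤ.- + 1 ℤ.- m) q
      ≡⟨ cong (λ x → coeff (A r k) x q) (K+S-1-m≡K-1-[m-S] (+ (r ℕ.* k)) (+ (r ℕ.* (n ∸ k))) m) ⟩
    coeff (A r k) (+ (r ℕ.* k) ℤ.- + 1 ℤ.- (m ℤ.- + (r ℕ.* (n ∸ k)))) q
      ≡⟨ A-palindromic 1≤r k q (m ℤ.- + (r ℕ.* (n ∸ k))) ⟩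
    coeff (A r k) (m ℤ.- + (r ℕ.* (n ∸ k))) q ∎

[1-t^N]-coeff-vanishes : ∀ N {i} j → i ≢ 0 → i ≢ N → coeff (1S ⊖ t^ N) (+ i) j ≡ + 0
[1-t^N]-coeff-vanishes N {i} j i≢0 i≢N = cong₂ ℤ._-_ (mono-≢ˡ 0 0 i j i≢0) (mono-≢ˡ N 0 i j i≢N)

qbin≡qbinom : ∀ r {n k} → k ≤ n → ∀ b → qbin r n k b ≡ qbinom r n k 0 b
qbin≡qbinom r {n} {k} k≤n b with k ℕ.≤? n
... | yes _   = ≡.refl
... | no  k≰n = ⊥-elim (k≰n k≤n)

qbin-Acoef-sum≡qbinom-A-sum : ∀ r n x j →
  sumTo (suc n) (λ k → qconv (qbin r n k) (Acoef r k x) j) ≡ qbinom-A-sum r n x j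
qbin-Acoef-sum≡qbinom-A-sum r n x j = sumTo-cong (suc n) λ k k<1+n →
  qconv-cong j (qbin≡qbinom r (ℕP.≤-pred k<1+n)) (Acoef≡coeff r k x)

open import Data.Nat using (_*_)
open import Data.Integer using (_-_)

mainTheorem4 : (r : ℕ) → 1 ≤ r → (i n : ℕ) → 1 ≤ i → 1 ≤ n → i ≢ r * n →
    (j : ℕ) →
    sumTo (suc n) (λ k → qconv (qbin r n k) (Acoef r k (+ (r * n) - + i - + 1)) j)
      ≡ sumTo (suc n) (λ k → qconv (qbin r n k) (Acoef r k (+ i - + 1)) j)
mainTheorem4 r 1≤r i n 1≤i _ i≢rn j = begin
  sumTo (suc n) (λ k → qconv (qbin r n k) (Acoef r k (N - + i - + 1)) j)
    ≡⟨ qbin-Acoef-sum≡qbinom-A-sum r n (N - + i - + 1) j ⟩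
  qbinom-A-sum r n (N - + i - + 1) j
    ≡⟨ cong (λ x → qbinom-A-sum r n x j) (N-i-1≡N-1-i N (+ i)) ⟩
  qbinom-A-sum r n (N - + 1 - + i) j
    ≡⟨ ℤP.i-j≡0⇒i≡j _ _ (≡.trans (qbinom-A-sum-reflection 1≤r n (+ i) j)
         ([1-t^N]-coeff-vanishes (r * n) j (ℕP.>⇒≢ 1≤i) i≢rn)) ⟩
  qbinom-A-sum r n (+ i - + 1) j
    ≡⟨ qbin-Acoef-sum≡qbinom-A-sum r n (+ i - + 1) j ⟨
  sumTo (suc n) (λ k → qconv (qbin r n k) (Acoef r k (+ i - + 1)) j) ∎
  where
  open ≡.≡-Reasoning
  N = + (r * n)
  N-i-1≡N-1-i : ∀ N i → N - i - + 1 ≡ N - + 1 - i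
  N-i-1≡N-1-i = solve-∀
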